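{- Let $q\ge2$. The size $|\Xi|$ of every $(q,d)$-blurer $\Xi$ is odd, and for every $d\ge3$ there exists a $(q,d)$-blurer.
   Context: For $\Xi\subseteq\mathbb{Z}_{2^q}^d$, $b\in\mathbb{Z}_{2^q}$ and $j\in[d]$ let $\#_{j,b}(\Xi)=|\{\bar a\in\Xi:a_j=b\}|\bmod2$. $\Xi$ is a $(q,d)$-blurer if (1) $\sum_j\xi(j)=0$ in $\mathbb{Z}_{2^q}$ for all $\xi\in\Xi$; (2) $\#_{1,2^{q-1}}(\Xi)=1$; (3) $\#_{j,0}(\Xi)=1$ for all $1<j\le d$; (4) $\#_{j,b}(\Xi)=0$ for all other pairs $b\in\mathbb{Z}_{2^q}$, $j\in[d]$. -}

module Defs where

open import Data.Nat using (ℕ; _^_; _∸_; _%_)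
open import Data.Nat.Divisibility using (_∣_)
open import Data.Fin using (Fin; toℕ; _≟_)
open import Data.Vec using (Vec; lookup; toList)
open import Data.List using (List; length; filter; map)
open import Data.Nat.ListAction using (sum)
import Data.List.Membership.Propositional
open import Data.List.Relation.Unary.Unique.Propositional using (Unique)
open import Data.Product using (_×_)
open import Relation.Nullary using (¬_)
open import Relation.Binary.PropositionalEquality using (_≡_; _≢_)

ℤ2^ : ℕ → Set
ℤ2^ q = Fin (2 ^ q)

-- points of ℤ_{2^q}^d; coordinate j ∈ [d] is index j-1 : Fin d.
Pt : ℕ → ℕ → Set
Pt q d = Vec (ℤ2^ q) d

count# : ∀ q {d} → Fin d → ℤ2^ q → List (Pt q d) → ℕ
count# q j b Ξ = length (filter (λ a → lookup a j ≟ b) Ξ) % 2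

record IsBlurer (q d : ℕ) (Ξ : List (Pt q d)) : Set where
  field
    distinct : Unique Ξ
    sumZero  : ∀ ξ → Data.List.Membership.Propositional._∈_ ξ Ξ →
               (2 ^ q) ∣ sum (map toℕ (toList ξ))
    -- (2) #_{1,2^{q-1}} = 1   (coordinate 1 is index 0)
    cond2    : ∀ (j : Fin d) (b : ℤ2^ q) → toℕ j ≡ 0 → toℕ b ≡ 2 ^ (q ∸ 1) →
               count# q j b Ξ ≡ 1
    cond3    : ∀ (j : Fin d) (b : ℤ2^ q) → toℕ j ≢ 0 → toℕ b ≡ 0 →
               count# q j b Ξ ≡ 1
    cond4    : ∀ (j : Fin d) (b : ℤ2^ q) →
               ¬ (toℕ j ≡ 0 × toℕ b ≡ 2 ^ (q ∸ 1)) →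
               ¬ (toℕ j ≢ 0 × toℕ b ≡ 0) →
               count# q j b Ξ ≡ 0

{-# OPTIONS --safe #-}
-- Summing the fibre sizes of the first coordinate gives |Ξ|, and modulo 2 only the
-- fibre over 2^(q-1) contributes, so |Ξ| is odd. For existence, with u = 2^(q-2) the
-- points (u, 0, 3u, 0, …), (u, 3u, 0, 0, …), (2u, 3u, 3u, 0, …) have coordinate sums
-- 4u, 4u, 8u; in every column two of them agree and cancel modulo 2, leaving the
-- value 2u in the first column and 0 in every other one.
module Submission where

open import Defs
open import Data.Empty using (⊥-elim)
open import Data.Nat using (ℕ; zero; suc; z≤n; s≤s; _+_; _*_; _^_; _%_; _≤_; _<_; NonZero)
open import Data.Nat.Properties
  using (+-0-commutativeMonoid; +-identityʳ; ≤-refl; n<1+n; *-monoˡ-<; *-cancelʳ-≡; m^n≢0;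
         ^-monoʳ-<; ^-distribˡ-+-*)
open import Data.Nat.DivMod using (%-distribˡ-+; m%n%n≡m%n; [m+kn]%n≡m%n)
open import Data.Nat.Divisibility using (_∣_; *-monoˡ-∣; divides)
open import Data.Nat.ListAction using (sum)
open import Data.Nat.Tactic.RingSolver using (solve-∀)
open import Data.Fin using (Fin; toℕ; fromℕ<; punchIn; _≟_) renaming (suc to fsuc)
open import Data.Fin.Patterns using (0F; 1F; 2F; 3F)
open import Data.Fin.Properties using (toℕ-fromℕ<; toℕ-injective; toℕ<n; punchInᵢ≢i)
open import Data.Vec using (lookup; toList; replicate; []; _∷_)
open import Data.Vec.Properties using (lookup-replicate)
open import Data.Vec.Functional using (Vector)
open import Data.List using (List; length; filter; map; []; _∷_)
open import Data.List.Properties using (filter-accept; filter-reject)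
open import Data.List.Relation.Binary.Permutation.Propositional using (_↭_; prep; swap; trans; refl)
open import Data.List.Relation.Binary.Permutation.Propositional.Properties using (↭-length; filter-↭)
open import Data.List.Relation.Unary.Any using (here; there)
open import Data.List.Relation.Unary.All using ([]; _∷_)
open import Data.List.Relation.Unary.AllPairs using ([]; _∷_)
open import Data.List.Membership.Propositional using (_∈_)
open import Data.List.Relation.Unary.Unique.Propositional using (Unique)
open import Data.Product using (_×_; _,_; ∃-syntax)
open import Function using (_∘_; case_of_)
open import Relation.Nullary using (¬_; yes; no)
open import Relation.Binary.PropositionalEquality
  using (_≡_; _≢_; refl; sym; cong; cong₂; subst; subst₂; module ≡-Reasoning)
  renaming (trans to ≡-trans)
open import Algebra.Properties.CommutativeMonoid.Sum +-0-commutativeMonoid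
  using (sum-remove; sum-cong-≗; sum-replicate-zero; ∑-distrib-+; sum-syntax)
  renaming (sum to ∑)

open ≡-Reasoning

∑-single : ∀ {n} (f : Vector ℕ n) i → (∀ j → j ≢ i → f j ≡ 0) → ∑ f ≡ f i
∑-single {suc n} f i f≡0 = begin
  ∑ f                              ≡⟨ sum-remove {i = i} f ⟩
  f i + ∑[ j < n ] f (punchIn i j) ≡⟨ cong (f i +_) (sum-cong-≗ (λ j → f≡0 _ (punchInᵢ≢i i j))) ⟩
  f i + ∑[ j < n ] 0               ≡⟨ cong (f i +_) (sum-replicate-zero n) ⟩
  f i + 0                          ≡⟨ +-identityʳ (f i) ⟩
  f i                              ∎

∑-% : ∀ {n} (f : Vector ℕ n) m .{{_ : NonZero m}} → ∑ f % m ≡ (∑[ i < n ] (f i % m)) % m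
∑-% {zero}  f m = refl
∑-% {suc n} f m = begin
  (f 0F + ∑ (f ∘ fsuc)) % m                              ≡⟨ %-distribˡ-+ (f 0F) _ m ⟩
  (f 0F % m + ∑ (f ∘ fsuc) % m) % m                      ≡⟨ cong₂ (λ a b → (a + b) % m)
                                                              (sym (m%n%n≡m%n (f 0F) m)) (∑-% (f ∘ fsuc) m) ⟩
  (f 0F % m % m + (∑[ i < n ] (f (fsuc i) % m)) % m) % m ≡⟨ %-distribˡ-+ (f 0F % m) _ m ⟨
  (f 0F % m + ∑[ i < n ] (f (fsuc i) % m)) % m           ∎

module _ {A : Set} {N : ℕ} (g : A → Fin N) where

  count : Fin N → List A → ℕ
  count b xs = length (filter (λ x → g x ≟ b) xs)

  count-singleton-≡ : ∀ {b} x → g x ≡ b → count b (x ∷ []) ≡ 1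
  count-singleton-≡ x gx≡b = cong length (filter-accept (λ x → g x ≟ _) gx≡b)

  count-singleton-≢ : ∀ {b} x → g x ≢ b → count b (x ∷ []) ≡ 0
  count-singleton-≢ x gx≢b = cong length (filter-reject (λ x → g x ≟ _) gx≢b)

  count-∷ : ∀ b x xs → count b (x ∷ xs) ≡ count b (x ∷ []) + count b xs
  count-∷ b x xs with g x ≟ b
  ... | yes _ = refl
  ... | no _  = refl

  count-↭ : ∀ b {xs ys} → xs ↭ ys → count b xs ≡ count b ys
  count-↭ b xs↭ys = ↭-length (filter-↭ (λ x → g x ≟ b) xs↭ys)

  count-singleton-cong : ∀ b x x′ → g x ≡ g x′ → count b (x ∷ []) ≡ count b (x′ ∷ [])
  count-singleton-cong b x x′ gx≡gx′ = case g x ≟ b of λ where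
    (yes gx≡b) → ≡-trans (count-singleton-≡ x gx≡b) (sym (count-singleton-≡ x′ (≡-trans (sym gx≡gx′) gx≡b)))
    (no gx≢b)  → ≡-trans (count-singleton-≢ x gx≢b) (sym (count-singleton-≢ x′ (gx≢b ∘ ≡-trans gx≡gx′)))

  count-pair-%2 : ∀ b x x′ xs → g x ≡ g x′ → count b (x ∷ x′ ∷ xs) % 2 ≡ count b xs % 2
  count-pair-%2 b x x′ xs gx≡gx′ = begin
    count b (x ∷ x′ ∷ xs) % 2          ≡⟨ cong (_% 2) (≡-trans (count-∷ b x _) (cong (c +_) (count-∷ b x′ xs))) ⟩
    (c + (count b (x′ ∷ []) + r)) % 2  ≡⟨ cong (λ c′ → (c + (c′ + r)) % 2) (count-singleton-cong b x x′ gx≡gx′) ⟨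
    (c + (c + r)) % 2                  ≡⟨ cong (_% 2) (c+[c+r]≡r+c*2 c r) ⟩
    (r + c * 2) % 2                    ≡⟨ [m+kn]%n≡m%n r c 2 ⟩
    r % 2                              ∎
    where
    c r : ℕ
    c = count b (x ∷ [])
    r = count b xs
    c+[c+r]≡r+c*2 : ∀ c r → c + (c + r) ≡ r + c * 2
    c+[c+r]≡r+c*2 = solve-∀

  ∑-count-singleton : ∀ x → ∑[ b < N ] count b (x ∷ []) ≡ 1
  ∑-count-singleton x = ≡-trans
    (∑-single _ (g x) (λ b b≢gx → count-singleton-≢ x (b≢gx ∘ sym)))
    (count-singleton-≡ x refl)

  length≡∑count : ∀ xs → length xs ≡ ∑[ b < N ] count b xs
  length≡∑count []       = sym (sum-replicate-zero N)
  length≡∑count (x ∷ xs) = begin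
    1 + length xs
      ≡⟨ cong₂ _+_ (sym (∑-count-singleton x)) (length≡∑count xs) ⟩
    ∑[ b < N ] count b (x ∷ []) + ∑[ b < N ] count b xs
      ≡⟨ ∑-distrib-+ (λ b → count b (x ∷ [])) (λ b → count b xs) ⟨
    ∑[ b < N ] (count b (x ∷ []) + count b xs)
      ≡⟨ sum-cong-≗ (λ b → count-∷ b x xs) ⟨
    ∑[ b < N ] count b (x ∷ xs)
      ∎

  length%2≡count%2 : ∀ h xs → (∀ b → b ≢ h → count b xs % 2 ≡ 0) → length xs % 2 ≡ count h xs % 2
  length%2≡count%2 h xs others-even = begin
    length xs % 2                     ≡⟨ cong (_% 2) (length≡∑count xs) ⟩
    (∑[ b < N ] count b xs) % 2       ≡⟨ ∑-% (λ b → count b xs) 2 ⟩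
    (∑[ b < N ] (count b xs % 2)) % 2 ≡⟨ cong (_% 2) (∑-single _ h others-even) ⟩
    count h xs % 2 % 2                ≡⟨ m%n%n≡m%n (count h xs) 2 ⟩
    count h xs % 2                    ∎

2^p<2^[1+p] : ∀ p → 2 ^ p < 2 ^ (1 + p)
2^p<2^[1+p] p = ^-monoʳ-< 2 ≤-refl (n<1+n p)

half : ∀ p → ℤ2^ (1 + p)
half p = fromℕ< (2^p<2^[1+p] p)

toℕ-half : ∀ p → toℕ (half p) ≡ 2 ^ p
toℕ-half p = toℕ-fromℕ< (2^p<2^[1+p] p)

blurer-length-odd : ∀ p d Ξ → IsBlurer (1 + p) (1 + d) Ξ → length Ξ % 2 ≡ 1
blurer-length-odd p d Ξ blurer =
  ≡-trans (length%2≡count%2 (λ ξ → lookup ξ 0F) (half p) Ξ others-even) (cond2 0F (half p) refl (toℕ-half p))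
  where
  open IsBlurer blurer
  others-even : ∀ b → b ≢ half p → count# (1 + p) 0F b Ξ ≡ 0
  others-even b b≢half = cond4 0F b (λ (_ , b≡2^p) → b≢half (toℕ-injective (≡-trans b≡2^p (sym (toℕ-half p)))))
                                    (λ (0≢0 , _) → 0≢0 refl)

module ThreePointBlurer (p m : ℕ) where

  private instance
    2^p≢0 : NonZero (2 ^ p)
    2^p≢0 = m^n≢0 2 p

  2^[2+p]≡4*2^p : 2 ^ (2 + p) ≡ 4 * 2 ^ p
  2^[2+p]≡4*2^p = ^-distribˡ-+-* 2 2 p

  quarter< : ∀ (k : Fin 4) → toℕ k * 2 ^ p < 2 ^ (2 + p)
  quarter< k = subst (toℕ k * 2 ^ p <_) (sym 2^[2+p]≡4*2^p) (*-monoˡ-< (2 ^ p) (toℕ<n k))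

  quarter : Fin 4 → ℤ2^ (2 + p)
  quarter k = fromℕ< (quarter< k)

  toℕ-quarter : ∀ k → toℕ (quarter k) ≡ toℕ k * 2 ^ p
  toℕ-quarter k = toℕ-fromℕ< (quarter< k)

  quarter-injective : ∀ {k k′} → quarter k ≡ quarter k′ → k ≡ k′
  quarter-injective {k} {k′} eq = toℕ-injective (*-cancelʳ-≡ (toℕ k) (toℕ k′) (2 ^ p)
    (≡-trans (sym (toℕ-quarter k)) (≡-trans (cong toℕ eq) (toℕ-quarter k′))))

  point : Fin 4 → Fin 4 → Fin 4 → Pt (2 + p) (3 + m)
  point a b c = quarter a ∷ quarter b ∷ quarter c ∷ replicate m (quarter 0F)

  coordinateSum : ∀ {d} → Pt (2 + p) d → ℕ
  coordinateSum ξ = sum (map toℕ (toList ξ))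

  coordinateSum-zeros : ∀ n → coordinateSum (replicate n (quarter 0F)) ≡ 0
  coordinateSum-zeros zero    = refl
  coordinateSum-zeros (suc n) = cong₂ _+_ (toℕ-quarter 0F) (coordinateSum-zeros n)

  coordinateSum-point : ∀ a b c → coordinateSum (point a b c) ≡ (toℕ a + toℕ b + toℕ c) * 2 ^ p
  coordinateSum-point a b c
    rewrite toℕ-quarter a | toℕ-quarter b | toℕ-quarter c | coordinateSum-zeros m =
    distrib (toℕ a) (toℕ b) (toℕ c) (2 ^ p)
    where
    distrib : ∀ a b c u → a * u + (b * u + (c * u + 0)) ≡ (a + b + c) * u
    distrib = solve-∀

  coordinateSum-point-∣ : ∀ a b c → 4 ∣ toℕ a + toℕ b + toℕ c → 2 ^ (2 + p) ∣ coordinateSum (point a b c)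
  coordinateSum-point-∣ a b c 4∣a+b+c =
    subst₂ _∣_ (sym 2^[2+p]≡4*2^p) (sym (coordinateSum-point a b c)) (*-monoˡ-∣ (2 ^ p) 4∣a+b+c)

  ξ₁ ξ₂ ξ₃ : Pt (2 + p) (3 + m)
  ξ₁ = point 1F 0F 3F
  ξ₂ = point 1F 3F 0F
  ξ₃ = point 2F 3F 3F

  Ξ : List (Pt (2 + p) (3 + m))
  Ξ = ξ₁ ∷ ξ₂ ∷ ξ₃ ∷ []

  Ξ-unique : Unique Ξ
  Ξ-unique = (ξ₁≢ξ₂ ∷ ξ₁≢ξ₃ ∷ []) ∷ (ξ₂≢ξ₃ ∷ []) ∷ [] ∷ []
    where
    differ-at : ∀ j {ξ ξ′ : Pt (2 + p) (3 + m)} → lookup ξ j ≢ lookup ξ′ j → ξ ≢ ξ′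
    differ-at j ξⱼ≢ξ′ⱼ = ξⱼ≢ξ′ⱼ ∘ cong (λ ξ → lookup ξ j)
    ξ₁≢ξ₂ : ξ₁ ≢ ξ₂
    ξ₁≢ξ₂ = differ-at 1F ((λ ()) ∘ quarter-injective {0F} {3F})
    ξ₁≢ξ₃ : ξ₁ ≢ ξ₃
    ξ₁≢ξ₃ = differ-at 0F ((λ ()) ∘ quarter-injective {1F} {2F})
    ξ₂≢ξ₃ : ξ₂ ≢ ξ₃
    ξ₂≢ξ₃ = differ-at 0F ((λ ()) ∘ quarter-injective {1F} {2F})

  Ξ-coordinateSum : ∀ ξ → ξ ∈ Ξ → 2 ^ (2 + p) ∣ coordinateSum ξ
  Ξ-coordinateSum _ (here refl)                 = coordinateSum-point-∣ 1F 0F 3F (divides 1 refl)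
  Ξ-coordinateSum _ (there (here refl))         = coordinateSum-point-∣ 1F 3F 0F (divides 1 refl)
  Ξ-coordinateSum _ (there (there (here refl))) = coordinateSum-point-∣ 2F 3F 3F (divides 2 refl)

  oddValue : Fin (3 + m) → ℤ2^ (2 + p)
  oddValue 0F       = quarter 2F
  oddValue (fsuc _) = quarter 0F

  unpaired : Fin (3 + m) → Pt (2 + p) (3 + m)
  unpaired 0F = ξ₃
  unpaired 1F = ξ₁
  unpaired 2F = ξ₂
  unpaired (fsuc (fsuc (fsuc _))) = ξ₃

  lookup-unpaired : ∀ j → lookup (unpaired j) j ≡ oddValue j
  lookup-unpaired 0F = refl
  lookup-unpaired 1F = refl
  lookup-unpaired 2F = refl
  lookup-unpaired (fsuc (fsuc (fsuc j))) = lookup-replicate j (quarter 0F)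

  coordinate : Fin (3 + m) → Pt (2 + p) (3 + m) → ℤ2^ (2 + p)
  coordinate j ξ = lookup ξ j

  count#-Ξ : ∀ j b → count# (2 + p) j b Ξ ≡ count (coordinate j) b (unpaired j ∷ []) % 2
  count#-Ξ 0F b = count-pair-%2 (coordinate 0F) b ξ₁ ξ₂ (ξ₃ ∷ []) refl
  count#-Ξ 1F b = ≡-trans
    (cong (_% 2) (count-↭ (coordinate 1F) b (trans (swap ξ₁ ξ₂ refl) (prep ξ₂ (swap ξ₁ ξ₃ refl)))))
    (count-pair-%2 (coordinate 1F) b ξ₂ ξ₃ (ξ₁ ∷ []) refl)
  count#-Ξ 2F b = ≡-trans
    (cong (_% 2) (count-↭ (coordinate 2F) b (prep ξ₁ (swap ξ₂ ξ₃ refl))))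
    (count-pair-%2 (coordinate 2F) b ξ₁ ξ₃ (ξ₂ ∷ []) refl)
  count#-Ξ j@(fsuc (fsuc (fsuc _))) b = count-pair-%2 (coordinate j) b ξ₁ ξ₂ (ξ₃ ∷ []) refl

  count#-oddValue : ∀ j → count# (2 + p) j (oddValue j) Ξ ≡ 1
  count#-oddValue j =
    ≡-trans (count#-Ξ j _) (cong (_% 2) (count-singleton-≡ (coordinate j) (unpaired j) (lookup-unpaired j)))

  count#-≢oddValue : ∀ j b → b ≢ oddValue j → count# (2 + p) j b Ξ ≡ 0
  count#-≢oddValue j b b≢oddValue = ≡-trans (count#-Ξ j b) (cong (_% 2)
    (count-singleton-≢ (coordinate j) (unpaired j) λ e → b≢oddValue (≡-trans (sym e) (lookup-unpaired j))))

  isBlurer : IsBlurer (2 + p) (3 + m) Ξ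
  isBlurer = record
    { distinct = Ξ-unique
    ; sumZero  = Ξ-coordinateSum
    ; cond2    = λ where
        0F b _ b≡2^[1+p] → subst (λ b → count# (2 + p) 0F b Ξ ≡ 1)
                             (toℕ-injective (≡-trans (toℕ-quarter 2F) (sym b≡2^[1+p])))
                             (count#-oddValue 0F)
        (fsuc _) _ () _
    ; cond3    = λ where
        0F _ 0≢0 _ → ⊥-elim (0≢0 refl)
        j@(fsuc _) b _ b≡0 → subst (λ b → count# (2 + p) j b Ξ ≡ 1)
                               (toℕ-injective (≡-trans (toℕ-quarter 0F) (sym b≡0)))
                               (count#-oddValue j)
    ; cond4    = λ j b ¬cond2 ¬cond3 → count#-≢oddValue j b (≢oddValue j b ¬cond2 ¬cond3)
    }
    where
    ≢oddValue : ∀ j b → ¬ (toℕ j ≡ 0 × toℕ b ≡ 2 ^ (1 + p)) → ¬ (toℕ j ≢ 0 × toℕ b ≡ 0) → b ≢ oddValue j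
    ≢oddValue 0F       b ¬cond2 _ b≡ = ¬cond2 (refl , ≡-trans (cong toℕ b≡) (toℕ-quarter 2F))
    ≢oddValue (fsuc _) b _ ¬cond3 b≡ = ¬cond3 ((λ ()) , ≡-trans (cong toℕ b≡) (toℕ-quarter 0F))

mainTheorem12 : ∀ (q : ℕ) → 2 ≤ q →
                    ((d : ℕ) → 1 ≤ d → (Ξ : List (Pt q d)) → IsBlurer q d Ξ →
                       length Ξ % 2 ≡ 1)
                    × ((d : ℕ) → 3 ≤ d → ∃[ Ξ ] IsBlurer q d Ξ)
mainTheorem12 (suc (suc p)) (s≤s (s≤s z≤n)) =
    (λ { (suc d) (s≤s z≤n) → blurer-length-odd (suc p) d })
  , (λ { (suc (suc (suc m))) (s≤s (s≤s (s≤s z≤n))) → Ξ p m , isBlurer p m })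
  where open ThreePointBlurer using (Ξ; isBlurer)
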